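{- Let $L$ be an IL-algebra in which every element is idempotent (i.e. $x\ast x=x$ for all $x\in L$), and let $F$ be a filter of $L$. Then $F$ is an implicative filter.
   Context: An IL-algebra is a structure $(L,\cup,\cap,\bot,\to,\ast,1)$ such that $(L,\cup,\cap)$ is a lattice (with order $\leq$) having least element $\bot$; $(L,\ast,1)$ is a commutative monoid with unit $1$; and for all $x,y,z\in L$, $x\ast y\leq z$ if and only if $x\leq y\to z$ (residuation). A filter of $L$ is a non-empty subset $F\subseteq L$ such that: $1\in F$; if $x,y\in F$ then $x\ast y\in F$ and $x\cap y\in F$; if $x\in F$ and $x\leq y$ then $y\in F$. A non-empty subset $F\subseteq L$ is an implicative filter if $1\in F$ and, for all $x,y,z\in L$, whenever $x\to(y\to z)\in F$ and $x\to y\in F$, then $x\to z\in F$. -}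

module Defs where

open import Level using (Level; suc; _⊔_)
open import Data.Product using (_×_; Σ)
open import Relation.Binary.PropositionalEquality using (_≡_)
open import Algebra.Lattice.Structures using (IsLattice)
open import Algebra.Structures using (IsCommutativeMonoid)
open import Function.Bundles using (_⇔_)

record ILAlgebra (a : Level) : Set (suc a) where
  infixr 5 _⇒_
  infixl 7 _∗_
  infix 4 _≤_
  field
    Carrier : Set a
    _∪_ _∩_ _⇒_ _∗_ : Carrier → Carrier → Carrier
    ⊥ 𝟙 : Carrier
    isLattice : IsLattice _≡_ _∪_ _∩_
    isCommMonoid : IsCommutativeMonoid _≡_ _∗_ 𝟙

  _≤_ : Carrier → Carrier → Set a
  x ≤ y = x ∩ y ≡ x

  field
    ⊥-least : ∀ x → ⊥ ≤ x
    residuation : ∀ x y z → (x ∗ y ≤ z) ⇔ (x ≤ y ⇒ z)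

module _ {a : Level} (L : ILAlgebra a) where
  open ILAlgebra L

  record IsFilter (F : Carrier → Set a) : Set a where
    field
      one∈ : F 𝟙
      ∗-closed : ∀ {x y} → F x → F y → F (x ∗ y)
      ∩-closed : ∀ {x y} → F x → F y → F (x ∩ y)
      up-closed : ∀ {x y} → F x → x ≤ y → F y

  -- implicative filter (non-emptiness is implied by 1 ∈ F)
  record IsImplicativeFilter (F : Carrier → Set a) : Set a where
    field
      one∈ : F 𝟙
      imp : ∀ {x y z} → F (x ⇒ (y ⇒ z)) → F (x ⇒ y) → F (x ⇒ z)

module Submission where

open import Defs
open import Level using (Level)
open import Relation.Binary.PropositionalEquality
  using (_≡_; refl; sym; trans; cong; subst₂; isEquivalence; module ≡-Reasoning)
open import Relation.Binary.Structures using (IsPreorder)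
open import Relation.Binary.Bundles using (Preorder)
import Relation.Binary.Reasoning.Preorder as PreorderReasoning
open import Algebra.Lattice.Structures using (IsLattice)
open import Algebra.Structures using (IsCommutativeMonoid)
open import Function.Bundles using (Equivalence)

-- With x ∗ x = x, the premise x can be used twice: once to detach y ⇒ z from
-- x ⇒ (y ⇒ z) and once to detach y from x ⇒ y.  Hence
-- (x ⇒ (y ⇒ z)) ∗ (x ⇒ y) ≤ x ⇒ z, and filters are upward closed under ∗.

module ILAlgebraProperties {a : Level} (L : ILAlgebra a) where
  open ILAlgebra L
  open IsLattice isLattice using (∧-assoc; ∨-absorbs-∧; ∧-absorbs-∨)
  open IsCommutativeMonoid isCommMonoid using (comm; assoc)

  residual : ∀ {x y z} → x ∗ y ≤ z → x ≤ y ⇒ z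
  residual {x} {y} {z} = Equivalence.to (residuation x y z)

  unresidual : ∀ {x y z} → x ≤ y ⇒ z → x ∗ y ≤ z
  unresidual {x} {y} {z} = Equivalence.from (residuation x y z)

  ≤-refl : ∀ x → x ≤ x
  ≤-refl x = trans (cong (x ∩_) (sym (∨-absorbs-∧ x x))) (∧-absorbs-∨ x (x ∩ x))

  ≤-reflexive : ∀ {x y} → x ≡ y → x ≤ y
  ≤-reflexive {x} refl = ≤-refl x

  ≤-trans : ∀ {x y z} → x ≤ y → y ≤ z → x ≤ z
  ≤-trans {x} {y} {z} x≤y y≤z = begin
    x ∩ z          ≡⟨ cong (_∩ z) (sym x≤y) ⟩
    (x ∩ y) ∩ z    ≡⟨ ∧-assoc x y z ⟩
    x ∩ (y ∩ z)    ≡⟨ cong (x ∩_) y≤z ⟩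
    x ∩ y          ≡⟨ x≤y ⟩
    x              ∎
    where open ≡-Reasoning

  ≤-isPreorder : IsPreorder _≡_ _≤_
  ≤-isPreorder = record
    { isEquivalence = isEquivalence
    ; reflexive     = ≤-reflexive
    ; trans         = ≤-trans
    }

  ≤-preorder : Preorder a a a
  ≤-preorder = record { isPreorder = ≤-isPreorder }

  module ≤-Reasoning = PreorderReasoning ≤-preorder

  modus-ponens : ∀ x y → (x ⇒ y) ∗ x ≤ y
  modus-ponens x y = unresidual (≤-refl (x ⇒ y))

  ∗-monoˡ-≤ : ∀ {u v} w → u ≤ v → u ∗ w ≤ v ∗ w
  ∗-monoˡ-≤ {v = v} w u≤v = unresidual (≤-trans u≤v (residual (≤-refl (v ∗ w))))

  ∗-monoʳ-≤ : ∀ {u v} w → u ≤ v → w ∗ u ≤ w ∗ v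
  ∗-monoʳ-≤ {u} {v} w u≤v = subst₂ _≤_ (comm u w) (comm v w) (∗-monoˡ-≤ w u≤v)

  ∗-mono-≤ : ∀ {u₁ v₁ u₂ v₂} → u₁ ≤ v₁ → u₂ ≤ v₂ → u₁ ∗ u₂ ≤ v₁ ∗ v₂
  ∗-mono-≤ {v₁ = v₁} {u₂} p q = ≤-trans (∗-monoˡ-≤ u₂ p) (∗-monoʳ-≤ v₁ q)

  ∗-distribʳ-idem : ∀ {x} → x ∗ x ≡ x → ∀ u v → u ∗ v ∗ x ≡ (u ∗ x) ∗ (v ∗ x)
  ∗-distribʳ-idem {x} idem u v = begin
    u ∗ v ∗ x          ≡⟨ cong (u ∗ v ∗_) (sym idem) ⟩
    u ∗ v ∗ (x ∗ x)    ≡⟨ assoc u v (x ∗ x) ⟩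
    u ∗ (v ∗ (x ∗ x))  ≡⟨ cong (u ∗_) (sym (assoc v x x)) ⟩
    u ∗ (v ∗ x ∗ x)    ≡⟨ cong (λ t → u ∗ (t ∗ x)) (comm v x) ⟩
    u ∗ (x ∗ v ∗ x)    ≡⟨ cong (u ∗_) (assoc x v x) ⟩
    u ∗ (x ∗ (v ∗ x))  ≡⟨ sym (assoc u x (v ∗ x)) ⟩
    u ∗ x ∗ (v ∗ x)    ∎
    where open ≡-Reasoning

  self-distributive-≤ : ∀ {x} → x ∗ x ≡ x → ∀ y z → (x ⇒ (y ⇒ z)) ∗ (x ⇒ y) ≤ x ⇒ z
  self-distributive-≤ {x} idem y z = residual (begin
    (x ⇒ (y ⇒ z)) ∗ (x ⇒ y) ∗ x          ≡⟨ ∗-distribʳ-idem idem (x ⇒ (y ⇒ z)) (x ⇒ y) ⟩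
    ((x ⇒ (y ⇒ z)) ∗ x) ∗ ((x ⇒ y) ∗ x)  ∼⟨ ∗-mono-≤ (modus-ponens x (y ⇒ z)) (modus-ponens x y) ⟩
    (y ⇒ z) ∗ y                          ∼⟨ modus-ponens y z ⟩
    z                                    ∎)
    where open ≤-Reasoning

  filter-implicative : (∀ x → x ∗ x ≡ x) → ∀ {F} → IsFilter L F → IsImplicativeFilter L F
  filter-implicative idem isFilter = record
    { one∈ = one∈
    ; imp  = λ {x} {y} {z} p q → up-closed (∗-closed p q) (self-distributive-≤ (idem x) y z)
    }
    where open IsFilter isFilter

mainTheorem10 : {a : Level} (L : ILAlgebra a) → (∀ x → ILAlgebra._∗_ L x x ≡ x) → (F : ILAlgebra.Carrier L → Set a) → IsFilter L F → IsImplicativeFilter L F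
mainTheorem10 L idem _ = ILAlgebraProperties.filter-implicative L idem
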